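{- Let $s,v,m$ be positive integers and $\epsilon\in\{1,-1\}$, excluding the case $\epsilon=-1$, $vm^2\le4$. Put $d=svm/2$, $k=s^2v(vm^2+4\epsilon)/4$, $\bar\xi=d-\sqrt{k}$, and $\delta_\epsilon=0$ if $\epsilon=1$, $\delta_\epsilon=1$ if $\epsilon=-1$. Then (a) $|\bar\xi|<1$ if and only if $m\ge s+\delta_\epsilon$; (b) $|\bar\xi|<1/2$ if and only if $m\ge 2s+\delta_\epsilon$. -}

module Defs where

open import Data.Nat as ℕ using (ℕ)
open import Data.Integer as ℤ using (ℤ; +_)
open import Data.Rational using (ℚ; _/_; _+_; _-_; _*_; _<_; 0ℚ)
open import Data.Product using (_×_)
open import Data.Sum using (_⊎_)

data Sign : Set where
  plus minus : Sign

⟦_⟧ : Sign → ℤ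
⟦ plus ⟧  = + 1
⟦ minus ⟧ = ℤ.- (+ 1)

δ : Sign → ℕ
δ plus  = 0
δ minus = 1

dd : ℕ → ℕ → ℕ → ℚ
dd s v m = (+ (s ℕ.* v ℕ.* m)) / 2

kk : ℕ → ℕ → ℕ → Sign → ℚ
kk s v m ε = ((+ (s ℕ.* s ℕ.* v)) ℤ.* ((+ (v ℕ.* m ℕ.* m)) ℤ.+ (+ 4) ℤ.* ⟦ ε ⟧)) / 4

-- y < √k   (for k ≥ 0), stated without real numbers
_<√_ : ℚ → ℚ → Set
y <√ k = y < 0ℚ ⊎ y * y < k

√_<_ : ℚ → ℚ → Set
√ k < y = 0ℚ < y × k < y * y

∣_-√_∣<_ : ℚ → ℚ → ℚ → Set
∣ a -√ k ∣< c = (a - c) <√ k × √ k < (a + c)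

{-# OPTIONS --safe #-}
-- Multiplying by 2, |d − √k| < c says A − C < √K < A + C for A = svm, K = 4k = A² + 4εq,
-- q = s²v and C = 2c ∈ {2, 1}. After squaring, A² cancels: for ε = 1 only the upper bound
-- constrains and reads 4q < 2CA + C²; for ε = −1 only the lower bound constrains (A ≥ 2 as
-- vm² ≥ 5) and reads C² + 4q < 2CA. Since q = sv·s and A = sv·m, cancelling sv turns these
-- into comparisons of s with m.
module Submission where

open import Defs
open import Data.Nat using (ℕ; _+_; _*_; _≤_)
open import Data.Rational using (1ℚ; ½)
open import Data.Product using (_×_)
open import Relation.Binary.PropositionalEquality using (_≡_)
open import Relation.Nullary using (¬_)
open import Function.Bundles using (_⇔_)

open import Data.Nat as ℕ using (_<_; _∸_; suc; z≤n; s≤s; NonZero)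
import Data.Nat.Properties as ℕP
import Data.Nat.Tactic.RingSolver as ℕSolver
open import Data.Integer as ℤ using (ℤ; +_; +<+; 0ℤ)
import Data.Integer.Properties as ℤP
import Data.Integer.Tactic.RingSolver as ℤSolver
open import Data.Rational as ℚ using (ℚ; _/_; toℚᵘ)
import Data.Rational.Properties as ℚP
open import Data.Rational.Unnormalised as ℚᵘ using (ℚᵘ; mkℚᵘ; *<*; *≡*)
import Data.Rational.Unnormalised.Properties as ℚᵘP
open import Data.Product using (_,_; proj₁; proj₂)
open import Data.Product.Function.NonDependent.Propositional using (_×-⇔_)
open import Data.Sum using (_⊎_; inj₁; inj₂; [_,_])
open import Data.Sum.Function.Propositional using (_⊎-⇔_)
open import Function using (id; _∘_)
open import Function.Bundles using (mk⇔; Equivalence)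
open import Function.Construct.Composition using (_⇔-∘_)
open import Relation.Binary.PropositionalEquality
  using (refl; sym; trans; cong; cong₂; subst; subst₂; module ≡-Reasoning)
open import Relation.Nullary using (contradiction)
open import Function.Related.Propositional using (module EquationalReasoning)

open Equivalence using (to)
open import Function.Properties.Equivalence using () renaming (refl to ⇔-refl)

private variable
  A B : Set

¬A⇒A⊎B⇔B : ¬ A → (A ⊎ B) ⇔ B
¬A⇒A⊎B⇔B ¬a = mk⇔ [ (λ a → contradiction a ¬a) , id ] inj₂

A⇒A×B⇔B : A → (A × B) ⇔ B
A⇒A×B⇔B a = mk⇔ proj₂ (a ,_)

B⇒A×B⇔A : B → (A × B) ⇔ A
B⇒A×B⇔A b = mk⇔ proj₁ (_, b)

toℚᵘ-/2 : ∀ X → toℚᵘ (X / 2) ℚᵘ.≃ mkℚᵘ X 1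
toℚᵘ-/2 X = ℚP.toℚᵘ-fromℚᵘ (mkℚᵘ X 1)

toℚᵘ-/4 : ∀ K → toℚᵘ (K / 4) ℚᵘ.≃ mkℚᵘ K 3
toℚᵘ-/4 K = ℚP.toℚᵘ-fromℚᵘ (mkℚᵘ K 3)

halves-+ᵘ : ∀ X Y → mkℚᵘ X 1 ℚᵘ.+ mkℚᵘ Y 1 ℚᵘ.≃ mkℚᵘ (X ℤ.+ Y) 1
halves-+ᵘ X Y = *≡* (identity X Y)
  where
  identity : ∀ X Y → (X ℤ.* + 2 ℤ.+ Y ℤ.* + 2) ℤ.* + 2 ≡ (X ℤ.+ Y) ℤ.* + 4
  identity = ℤSolver.solve-∀

/2-+ : ∀ X Y → X / 2 ℚ.+ Y / 2 ≡ (X ℤ.+ Y) / 2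
/2-+ X Y = ℚP.toℚᵘ-injective (begin
  toℚᵘ (X / 2 ℚ.+ Y / 2)          ≈⟨ ℚP.toℚᵘ-homo-+ (X / 2) (Y / 2) ⟩
  toℚᵘ (X / 2) ℚᵘ.+ toℚᵘ (Y / 2) ≈⟨ ℚᵘP.+-cong (toℚᵘ-/2 X) (toℚᵘ-/2 Y) ⟩
  mkℚᵘ X 1 ℚᵘ.+ mkℚᵘ Y 1         ≈⟨ halves-+ᵘ X Y ⟩
  mkℚᵘ (X ℤ.+ Y) 1                ≈⟨ toℚᵘ-/2 (X ℤ.+ Y) ⟨
  toℚᵘ ((X ℤ.+ Y) / 2)            ∎)
  where open ℚᵘP.≃-Reasoning

/2-- : ∀ X Y → X / 2 ℚ.- Y / 2 ≡ (X ℤ.- Y) / 2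
/2-- X Y = ℚP.toℚᵘ-injective (begin
  toℚᵘ (X / 2 ℚ.- Y / 2)              ≈⟨ ℚP.toℚᵘ-homo-+ (X / 2) (ℚ.- (Y / 2)) ⟩
  toℚᵘ (X / 2) ℚᵘ.+ toℚᵘ (ℚ.- (Y / 2)) ≈⟨ ℚᵘP.+-cong (toℚᵘ-/2 X) -Y/2≃ ⟩
  mkℚᵘ X 1 ℚᵘ.+ mkℚᵘ (ℤ.- Y) 1        ≈⟨ halves-+ᵘ X (ℤ.- Y) ⟩
  mkℚᵘ (X ℤ.- Y) 1                     ≈⟨ toℚᵘ-/2 (X ℤ.- Y) ⟨
  toℚᵘ ((X ℤ.- Y) / 2)                 ∎)
  where
  open ℚᵘP.≃-Reasoning
  -Y/2≃ : toℚᵘ (ℚ.- (Y / 2)) ℚᵘ.≃ mkℚᵘ (ℤ.- Y) 1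
  -Y/2≃ = ℚᵘP.≃-trans (ℚP.toℚᵘ-homo‿- (Y / 2)) (ℚᵘP.-‿cong (toℚᵘ-/2 Y))

<⇔toℚᵘ< : ∀ {p q : ℚ} {a b : ℚᵘ} → toℚᵘ p ℚᵘ.≃ a → toℚᵘ q ℚᵘ.≃ b → p ℚ.< q ⇔ a ℚᵘ.< b
<⇔toℚᵘ< p≃a q≃b = mk⇔
  (λ p<q → ℚᵘP.<-respˡ-≃ p≃a (ℚᵘP.<-respʳ-≃ q≃b (ℚP.toℚᵘ-mono-< p<q)))
  (λ a<b → ℚP.toℚᵘ-cancel-< (ℚᵘP.<-respˡ-≃ (ℚᵘP.≃-sym p≃a) (ℚᵘP.<-respʳ-≃ (ℚᵘP.≃-sym q≃b) a<b)))

mkℚᵘ<mkℚᵘ⇔< : ∀ d {X Y} → mkℚᵘ X d ℚᵘ.< mkℚᵘ Y d ⇔ X ℤ.< Y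
mkℚᵘ<mkℚᵘ⇔< d = mk⇔
  (λ { (*<* X<Y) → ℤP.*-cancelʳ-<-nonNeg (+ suc d) X<Y })
  (λ X<Y → *<* (ℤP.*-monoʳ-<-pos (+ suc d) X<Y))

/2<√/4⇔ : ∀ X K → (X / 2) <√ (K / 4) ⇔ (X ℤ.< 0ℤ ⊎ X ℤ.* X ℤ.< K)
/2<√/4⇔ X K = negative ⊎-⇔ square
  where
  negative = mkℚᵘ<mkℚᵘ⇔< 1 ⇔-∘ <⇔toℚᵘ< (toℚᵘ-/2 X) (*≡* refl)
  X/2²≃ = ℚᵘP.≃-trans (ℚP.toℚᵘ-homo-* (X / 2) (X / 2)) (ℚᵘP.*-cong (toℚᵘ-/2 X) (toℚᵘ-/2 X))
  square = mkℚᵘ<mkℚᵘ⇔< 3 ⇔-∘ <⇔toℚᵘ< X/2²≃ (toℚᵘ-/4 K)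

√/4</2⇔ : ∀ K Y → (√ (K / 4) < (Y / 2)) ⇔ (0ℤ ℤ.< Y × K ℤ.< Y ℤ.* Y)
√/4</2⇔ K Y = positive ×-⇔ square
  where
  positive = mkℚᵘ<mkℚᵘ⇔< 1 ⇔-∘ <⇔toℚᵘ< (*≡* refl) (toℚᵘ-/2 Y)
  Y/2²≃ = ℚᵘP.≃-trans (ℚP.toℚᵘ-homo-* (Y / 2) (Y / 2)) (ℚᵘP.*-cong (toℚᵘ-/2 Y) (toℚᵘ-/2 Y))
  square = mkℚᵘ<mkℚᵘ⇔< 3 ⇔-∘ <⇔toℚᵘ< (toℚᵘ-/4 K) Y/2²≃

infix 4 ∣_-√_∣<ℤ_ ∣_-√_∣<ℕ_

∣_-√_∣<ℤ_ : ℤ → ℤ → ℤ → Set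
∣ X -√ K ∣<ℤ C = (X ℤ.- C ℤ.< 0ℤ ⊎ (X ℤ.- C) ℤ.* (X ℤ.- C) ℤ.< K)
               × (0ℤ ℤ.< X ℤ.+ C × K ℤ.< (X ℤ.+ C) ℤ.* (X ℤ.+ C))

∣/2-√/4∣</2⇔ : ∀ X K C → ∣ X / 2 -√ K / 4 ∣< (C / 2) ⇔ ∣ X -√ K ∣<ℤ C
∣/2-√/4∣</2⇔ X K C =
  subst₂ (λ l r → (l <√ (K / 4) × √ (K / 4) < r) ⇔ ∣ X -√ K ∣<ℤ C) (sym (/2-- X C)) (sym (/2-+ X C))
    (/2<√/4⇔ (X ℤ.- C) K ×-⇔ √/4</2⇔ K (X ℤ.+ C))

m+n-n≡m : ∀ m n → m ℤ.+ n ℤ.- n ≡ m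
m+n-n≡m = ℤSolver.solve-∀

m-n+n≡m : ∀ m n → m ℤ.- n ℤ.+ n ≡ m
m-n+n≡m = ℤSolver.solve-∀

<⇔ℕ<-after-shift : ∀ z {x y : ℤ} {m n : ℕ} → x ℤ.+ z ≡ + m → y ℤ.+ z ≡ + n → x ℤ.< y ⇔ m < n
<⇔ℕ<-after-shift z {x} {y} x+z≡m y+z≡n = mk⇔
  (λ x<y → ℤP.drop‿+<+ (subst₂ ℤ._<_ x+z≡m y+z≡n (ℤP.+-monoˡ-< z x<y)))
  (λ m<n → subst₂ ℤ._<_ (m+n-n≡m x z) (m+n-n≡m y z)
    (ℤP.+-monoˡ-< (ℤ.- z) (subst₂ ℤ._<_ (sym x+z≡m) (sym y+z≡n) (+<+ m<n))))

-- (a - c)² < n is written as a² + c² < n + 2ca to avoid truncated subtraction.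
∣_-√_∣<ℕ_ : ℕ → ℕ → ℕ → Set
∣ a -√ n ∣<ℕ c = (a < c ⊎ a * a + c * c < n + 2 * c * a) × n < (a + c) * (a + c)

∣+-√+∣<ℤ+⇔ : ∀ a n c → 1 ≤ c → ∣ + a -√ + n ∣<ℤ + c ⇔ ∣ a -√ n ∣<ℕ c
∣+-√+∣<ℤ+⇔ a n c c≥1 = (negative ⊎-⇔ square) ×-⇔ (upper ⇔-∘ A⇒A×B⇔B positive)
  where
  square-of-difference : ∀ X C → (X ℤ.- C) ℤ.* (X ℤ.- C) ℤ.+ + 2 ℤ.* C ℤ.* X ≡ X ℤ.* X ℤ.+ C ℤ.* C
  square-of-difference = ℤSolver.solve-∀

  shifted-square : (+ a ℤ.- + c) ℤ.* (+ a ℤ.- + c) ℤ.+ + (2 * c * a) ≡ + (a * a + c * c)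
  shifted-square = begin
    (+ a ℤ.- + c) ℤ.* (+ a ℤ.- + c) ℤ.+ + (2 * c * a)
      ≡⟨ cong (ℤ._+_ ((+ a ℤ.- + c) ℤ.* (+ a ℤ.- + c)))
              (trans (ℤP.pos-* (2 * c) a) (cong (ℤ._* + a) (ℤP.pos-* 2 c))) ⟩
    (+ a ℤ.- + c) ℤ.* (+ a ℤ.- + c) ℤ.+ + 2 ℤ.* + c ℤ.* + a
      ≡⟨ square-of-difference (+ a) (+ c) ⟩
    + a ℤ.* + a ℤ.+ + c ℤ.* + c
      ≡⟨ cong₂ ℤ._+_ (ℤP.pos-* a a) (ℤP.pos-* c c) ⟨
    + (a * a + c * c) ∎
    where open ≡-Reasoning

  negative : + a ℤ.- + c ℤ.< 0ℤ ⇔ a < c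
  negative = <⇔ℕ<-after-shift (+ c) (m-n+n≡m (+ a) (+ c)) refl

  square : (+ a ℤ.- + c) ℤ.* (+ a ℤ.- + c) ℤ.< + n ⇔ a * a + c * c < n + 2 * c * a
  square = <⇔ℕ<-after-shift (+ (2 * c * a)) shifted-square refl

  positive : 0ℤ ℤ.< + a ℤ.+ + c
  positive = +<+ (ℕP.<-≤-trans c≥1 (ℕP.m≤n+m c a))

  upper : + n ℤ.< (+ a ℤ.+ + c) ℤ.* (+ a ℤ.+ + c) ⇔ n < (a + c) * (a + c)
  upper = <⇔ℕ<-after-shift 0ℤ (ℤP.+-identityʳ (+ n))
    (trans (ℤP.+-identityʳ _) (sym (ℤP.pos-* (a + c) (a + c))))

∣+/2-√+/4∣<+/2⇔ : ∀ a n c → 1 ≤ c → ∣ + a / 2 -√ + n / 4 ∣< (+ c / 2) ⇔ ∣ a -√ n ∣<ℕ c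
∣+/2-√+/4∣<+/2⇔ a n c c≥1 = ∣+-√+∣<ℤ+⇔ a n c c≥1 ⇔-∘ ∣/2-√/4∣</2⇔ (+ a) (+ n) (+ c)

k+m<k+n⇔m<n : ∀ k {m n} → k + m < k + n ⇔ m < n
k+m<k+n⇔m<n k = mk⇔ (ℕP.+-cancelˡ-< k _ _) (ℕP.+-monoʳ-< k)

m<n⇔m+k<n+k : ∀ k {m n} → m < n ⇔ m + k < n + k
m<n⇔m+k<n+k k = mk⇔ (ℕP.+-monoˡ-< k) (ℕP.+-cancelʳ-< k _ _)

∣-√a²+4q∣<ℕ⇔ : ∀ a q c → 1 ≤ q → c ≤ 2 * a → ∣ a -√ a * a + 4 * q ∣<ℕ c ⇔ 4 * q < 2 * c * a + c * c
∣-√a²+4q∣<ℕ⇔ a q c q≥1 c≤2a = upper ⇔-∘ A⇒A×B⇔B (inj₂ lower)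
  where
  c²≤2ca : c * c ≤ 2 * c * a
  c²≤2ca = subst (c * c ≤_) (rearrange c a) (ℕP.*-monoʳ-≤ c c≤2a)
    where
    rearrange : ∀ c a → c * (2 * a) ≡ 2 * c * a
    rearrange = ℕSolver.solve-∀

  lower : a * a + c * c < a * a + 4 * q + 2 * c * a
  lower = begin-strict
    a * a + c * c               ≤⟨ ℕP.+-monoʳ-≤ (a * a) c²≤2ca ⟩
    a * a + 2 * c * a           <⟨ ℕP.+-monoʳ-< (a * a) (ℕP.m<n+m (2 * c * a) (ℕP.*-monoʳ-< 4 q≥1)) ⟩
    a * a + (4 * q + 2 * c * a) ≡⟨ ℕP.+-assoc (a * a) (4 * q) (2 * c * a) ⟨
    a * a + 4 * q + 2 * c * a   ∎
    where open ℕP.≤-Reasoning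

  square-of-sum : ∀ a c → (a + c) * (a + c) ≡ a * a + (2 * c * a + c * c)
  square-of-sum = ℕSolver.solve-∀

  upper : a * a + 4 * q < (a + c) * (a + c) ⇔ 4 * q < 2 * c * a + c * c
  upper = subst (λ t → a * a + 4 * q < t ⇔ 4 * q < 2 * c * a + c * c) (sym (square-of-sum a c))
            (k+m<k+n⇔m<n (a * a))

∣-√a²-4q∣<ℕ⇔ : ∀ a q c n → n + 4 * q ≡ a * a → 1 ≤ c
  → ∣ a -√ n ∣<ℕ c ⇔ (a < c ⊎ c * c + 4 * q < 2 * c * a)
∣-√a²-4q∣<ℕ⇔ a q c n n+4q≡a² c≥1 = (⇔-refl ⊎-⇔ lower) ⇔-∘ B⇒A×B⇔A upper
  where
  upper : n < (a + c) * (a + c)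
  upper = ℕP.≤-<-trans (subst (n ≤_) n+4q≡a² (ℕP.m≤m+n n (4 * q))) (ℕP.*-mono-< a<a+c a<a+c)
    where a<a+c = ℕP.m<m+n a c≥1

  shifted : n + 2 * c * a + 4 * q ≡ a * a + 2 * c * a
  shifted = trans (swap-last n (2 * c * a) (4 * q)) (cong (_+ 2 * c * a) n+4q≡a²)
    where
    swap-last : ∀ n x y → n + x + y ≡ n + y + x
    swap-last = ℕSolver.solve-∀

  lower : a * a + c * c < n + 2 * c * a ⇔ c * c + 4 * q < 2 * c * a
  lower = begin
    a * a + c * c < n + 2 * c * a                 ∼⟨ m<n⇔m+k<n+k (4 * q) ⟩
    a * a + c * c + 4 * q < n + 2 * c * a + 4 * q ≡⟨ cong₂ _<_ (ℕP.+-assoc (a * a) (c * c) (4 * q)) shifted ⟩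
    a * a + (c * c + 4 * q) < a * a + 2 * c * a   ∼⟨ k+m<k+n⇔m<n (a * a) ⟩
    c * c + 4 * q < 2 * c * a                     ∎
    where open EquationalReasoning

svm²≡ssv*vmm : ∀ s v m → s * v * m * (s * v * m) ≡ s * s * v * (v * m * m)
svm²≡ssv*vmm = ℕSolver.solve-∀

kk-plus : ∀ s v m → kk s v m plus ≡ + (s * v * m * (s * v * m) + 4 * (s * s * v)) / 4
kk-plus s v m = cong (_/ 4) (trans (sym (ℤP.pos-* (s * s * v) (v * m * m + 4))) (cong +_ (expand s v m)))
  where
  expand : ∀ s v m → s * s * v * (v * m * m + 4) ≡ s * v * m * (s * v * m) + 4 * (s * s * v)
  expand = ℕSolver.solve-∀

kk-minus : ∀ s v m → 4 ≤ v * m * m → kk s v m minus ≡ + (s * s * v * (v * m * m ∸ 4)) / 4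
kk-minus s v m vmm≥4 =
  cong (_/ 4) (trans (cong (+ (s * s * v) ℤ.*_) (ℤP.⊖-≥ vmm≥4)) (sym (ℤP.pos-* (s * s * v) _)))

ssv[vmm∸4]+4ssv≡svm² : ∀ s v m → 4 ≤ v * m * m
  → s * s * v * (v * m * m ∸ 4) + 4 * (s * s * v) ≡ s * v * m * (s * v * m)
ssv[vmm∸4]+4ssv≡svm² s v m vmm≥4 = begin
  s * s * v * (v * m * m ∸ 4) + 4 * (s * s * v) ≡⟨ factor (s * s * v) (v * m * m ∸ 4) ⟩
  s * s * v * (v * m * m ∸ 4 + 4)               ≡⟨ cong (s * s * v *_) (ℕP.m∸n+n≡m vmm≥4) ⟩
  s * s * v * (v * m * m)                       ≡⟨ svm²≡ssv*vmm s v m ⟨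
  s * v * m * (s * v * m)                       ∎
  where
  open ≡-Reasoning
  factor : ∀ q x → q * x + 4 * q ≡ q * (x + 4)
  factor = ℕSolver.solve-∀

-- For c = 2 and c = 1, + c / 2 is definitionally 1ℚ and ½.
∣dd-√kk⁺∣<⇔ : ∀ s v m c → 1 ≤ s → 1 ≤ v → 1 ≤ m → 1 ≤ c → c ≤ 2
  → ∣ dd s v m -√ kk s v m plus ∣< (+ c / 2) ⇔ 4 * (s * s * v) < 2 * c * (s * v * m) + c * c
∣dd-√kk⁺∣<⇔ s v m c s≥1 v≥1 m≥1 c≥1 c≤2 rewrite kk-plus s v m =
  ∣-√a²+4q∣<ℕ⇔ (s * v * m) (s * s * v) c ssv≥1 c≤2svm ⇔-∘ ∣+/2-√+/4∣<+/2⇔ (s * v * m) _ c c≥1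
  where
  ssv≥1 = ℕP.*-mono-≤ (ℕP.*-mono-≤ s≥1 s≥1) v≥1
  c≤2svm = ℕP.≤-trans c≤2 (ℕP.*-monoʳ-≤ 2 (ℕP.*-mono-≤ (ℕP.*-mono-≤ s≥1 v≥1) m≥1))

∣dd-√kk⁻∣<⇔ : ∀ s v m c → 1 ≤ s → 1 ≤ v → 5 ≤ v * m * m → 1 ≤ c → c ≤ 2
  → ∣ dd s v m -√ kk s v m minus ∣< (+ c / 2) ⇔ c * c + 4 * (s * s * v) < 2 * c * (s * v * m)
∣dd-√kk⁻∣<⇔ s v m c s≥1 v≥1 vmm≥5 c≥1 c≤2 rewrite kk-minus s v m (ℕP.<⇒≤ vmm≥5) =
  ¬A⇒A⊎B⇔B svm≮c
    ⇔-∘ (∣-√a²-4q∣<ℕ⇔ (s * v * m) (s * s * v) c n n+4ssv≡svm² c≥1 ⇔-∘ ∣+/2-√+/4∣<+/2⇔ (s * v * m) n c c≥1)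
  where
  n = s * s * v * (v * m * m ∸ 4)
  n+4ssv≡svm² = ssv[vmm∸4]+4ssv≡svm² s v m (ℕP.<⇒≤ vmm≥5)
  instance
    ssv≢0 : NonZero (s * s * v)
    ssv≢0 = ℕ.>-nonZero (ℕP.*-mono-≤ (ℕP.*-mono-≤ s≥1 s≥1) v≥1)
  vmm≤svm² : v * m * m ≤ s * v * m * (s * v * m)
  vmm≤svm² = subst (v * m * m ≤_) (sym (svm²≡ssv*vmm s v m)) (ℕP.m≤n*m (v * m * m) (s * s * v))
  svm≮c : ¬ s * v * m < c
  svm≮c svm<c =
    contradiction (ℕP.≤-trans vmm≥5 (ℕP.≤-trans vmm≤svm² (ℕP.*-mono-≤ svm≤1 svm≤1))) λ { (s≤s ()) }
    where svm≤1 = ℕP.m<1+n⇒m≤n (ℕP.<-≤-trans svm<c c≤2)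

k*m≤k*n⇔m≤n : ∀ k .{{_ : NonZero k}} {m n} → k * m ≤ k * n ⇔ m ≤ n
k*m≤k*n⇔m≤n k = mk⇔ (ℕP.*-cancelˡ-≤ k) (ℕP.*-monoʳ-≤ k)

k*m<k*n⇔m<n : ∀ k .{{_ : NonZero k}} {m n} → k * m < k * n ⇔ m < n
k*m<k*n⇔m<n k = mk⇔ (ℕP.*-cancelˡ-< k _ _) (ℕP.*-monoʳ-< k)

m<1+n⇔m≤n : ∀ {m n} → m < suc n ⇔ m ≤ n
m<1+n⇔m≤n = mk⇔ ℕP.m<1+n⇒m≤n s≤s

ssv≡sv*s : ∀ s v → s * s * v ≡ s * v * s
ssv≡sv*s = ℕSolver.solve-∀

2ssv≡sv*2s : ∀ s v → 2 * (s * s * v) ≡ s * v * (2 * s)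
2ssv≡sv*2s = ℕSolver.solve-∀

4ssv<4svm+4⇔s≤m : ∀ s v m → 1 ≤ s * v → 4 * (s * s * v) < 4 * (s * v * m) + 4 ⇔ s ≤ m
4ssv<4svm+4⇔s≤m s v m sv≥1 = begin
  4 * (s * s * v) < 4 * (s * v * m) + 4
    ≡⟨ cong₂ _<_ (cong (4 *_) (ssv≡sv*s s v)) (4n+4≡4[1+n] (s * v * m)) ⟩
  4 * (s * v * s) < 4 * suc (s * v * m) ∼⟨ k*m<k*n⇔m<n 4 ⟩
  s * v * s < suc (s * v * m)           ∼⟨ m<1+n⇔m≤n ⟩
  s * v * s ≤ s * v * m                 ∼⟨ k*m≤k*n⇔m≤n (s * v) {{ℕ.>-nonZero sv≥1}} ⟩
  s ≤ m                                 ∎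
  where
  open EquationalReasoning
  4n+4≡4[1+n] : ∀ n → 4 * n + 4 ≡ 4 * suc n
  4n+4≡4[1+n] = ℕSolver.solve-∀

4ssv<2svm+1⇔2s≤m : ∀ s v m → 1 ≤ s * v → 4 * (s * s * v) < 2 * (s * v * m) + 1 ⇔ 2 * s ≤ m
4ssv<2svm+1⇔2s≤m s v m sv≥1 = begin
  4 * (s * s * v) < 2 * (s * v * m) + 1   ≡⟨ cong (4 * (s * s * v) <_) (ℕP.+-comm (2 * (s * v * m)) 1) ⟩
  4 * (s * s * v) < suc (2 * (s * v * m)) ∼⟨ m<1+n⇔m≤n ⟩
  4 * (s * s * v) ≤ 2 * (s * v * m)       ≡⟨ cong (_≤ 2 * (s * v * m)) (ℕP.*-assoc 2 2 (s * s * v)) ⟩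
  2 * (2 * (s * s * v)) ≤ 2 * (s * v * m) ∼⟨ k*m≤k*n⇔m≤n 2 ⟩
  2 * (s * s * v) ≤ s * v * m             ≡⟨ cong (_≤ s * v * m) (2ssv≡sv*2s s v) ⟩
  s * v * (2 * s) ≤ s * v * m             ∼⟨ k*m≤k*n⇔m≤n (s * v) {{ℕ.>-nonZero sv≥1}} ⟩
  2 * s ≤ m                               ∎
  where open EquationalReasoning

2≤p⇒1+p*m<p*n : ∀ {p m n} → 2 ≤ p → m < n → suc (p * m) < p * n
2≤p⇒1+p*m<p*n {p} {m} {n} p≥2 m<n = begin
  2 + p * m ≤⟨ ℕP.+-monoˡ-≤ (p * m) p≥2 ⟩
  p + p * m ≡⟨ ℕP.*-suc p m ⟨
  p * suc m ≤⟨ ℕP.*-monoʳ-≤ p m<n ⟩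
  p * n     ∎
  where open ℕP.≤-Reasoning

-- Only s = v = 1 needs 5 ≤ vm²: then the claim is 2 < m, and m = 2 gives vm² = 4.
1+ssv<svm : ∀ s v m → 1 ≤ s → 1 ≤ v → 5 ≤ v * m * m → s < m → suc (s * s * v) < s * v * m
1+ssv<svm 1 1 (suc (suc (suc _))) _ _ _ _ = s≤s (s≤s (s≤s z≤n))
1+ssv<svm 1 1 2 _ _ (s≤s (s≤s (s≤s (s≤s ())))) _
1+ssv<svm 1 1 1 _ _ _ (s≤s ())
1+ssv<svm s@(suc (suc _)) v@(suc _) m _ _ _ s<m =
  subst (λ q → suc q < s * v * m) (sym (ssv≡sv*s s v))
    (2≤p⇒1+p*m<p*n (ℕP.≤-trans (s≤s (s≤s z≤n)) (ℕP.m≤m*n s v)) s<m)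
1+ssv<svm 1 v@(suc (suc _)) m _ _ _ s<m =
  subst (λ q → suc q < 1 * v * m) (sym (ssv≡sv*s 1 v))
    (2≤p⇒1+p*m<p*n (ℕP.≤-trans (s≤s (s≤s z≤n)) (ℕP.m≤n*m v 1)) s<m)

4+4ssv<4svm⇔s+1≤m : ∀ s v m → 1 ≤ s → 1 ≤ v → 5 ≤ v * m * m
  → 4 + 4 * (s * s * v) < 4 * (s * v * m) ⇔ s + 1 ≤ m
4+4ssv<4svm⇔s+1≤m s v m s≥1 v≥1 vmm≥5 = begin
  4 + 4 * (s * s * v) < 4 * (s * v * m) ≡⟨ cong (_< 4 * (s * v * m)) (ℕP.*-suc 4 (s * s * v)) ⟨
  4 * suc (s * s * v) < 4 * (s * v * m) ∼⟨ k*m<k*n⇔m<n 4 ⟩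
  suc (s * s * v) < s * v * m           ∼⟨ mk⇔ (cancel ∘ ℕP.<⇒≤) (1+ssv<svm s v m s≥1 v≥1 vmm≥5) ⟩
  s < m                                 ≡⟨ cong (_≤ m) (ℕP.+-comm 1 s) ⟩
  s + 1 ≤ m                             ∎
  where
  open EquationalReasoning
  cancel : s * s * v < s * v * m → s < m
  cancel = to (k*m<k*n⇔m<n (s * v) {{ℕ.>-nonZero (ℕP.*-mono-≤ s≥1 v≥1)}})
         ∘ subst (_< s * v * m) (ssv≡sv*s s v)

1+4ssv<2svm⇔2s+1≤m : ∀ s v m → 1 ≤ s * v → 1 + 4 * (s * s * v) < 2 * (s * v * m) ⇔ 2 * s + 1 ≤ m
1+4ssv<2svm⇔2s+1≤m s v m sv≥1 = begin
  1 + 4 * (s * s * v) < 2 * (s * v * m)     ≡⟨⟩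
  2 + 4 * (s * s * v) ≤ 2 * (s * v * m)     ≡⟨ cong (_≤ 2 * (s * v * m)) (2+4q≡2[1+2q] (s * s * v)) ⟩
  2 * suc (2 * (s * s * v)) ≤ 2 * (s * v * m) ∼⟨ k*m≤k*n⇔m≤n 2 ⟩
  2 * (s * s * v) < s * v * m               ≡⟨ cong (_< s * v * m) (2ssv≡sv*2s s v) ⟩
  s * v * (2 * s) < s * v * m               ∼⟨ k*m<k*n⇔m<n (s * v) {{ℕ.>-nonZero sv≥1}} ⟩
  2 * s < m                                 ≡⟨ cong (_≤ m) (ℕP.+-comm 1 (2 * s)) ⟩
  2 * s + 1 ≤ m                             ∎
  where
  open EquationalReasoning
  2+4q≡2[1+2q] : ∀ q → 2 + 4 * q ≡ 2 * suc (2 * q)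
  2+4q≡2[1+2q] = ℕSolver.solve-∀

lemma4p1 : (s v m : ℕ) → 1 ≤ s → 1 ≤ v → 1 ≤ m → (ε : Sign)
    → ¬ (ε ≡ minus × v * (m * m) ≤ 4)
    → (∣ dd s v m -√ kk s v m ε ∣< 1ℚ ⇔ s + δ ε ≤ m)
    × (∣ dd s v m -√ kk s v m ε ∣< ½ ⇔ 2 * s + δ ε ≤ m)
lemma4p1 s v m s≥1 v≥1 m≥1 plus _ =
    +0≤m (4ssv<4svm+4⇔s≤m s v m sv≥1 ⇔-∘ ∣dd-√kk⁺∣<⇔ s v m 2 s≥1 v≥1 m≥1 (s≤s z≤n) ℕP.≤-refl)
  , +0≤m (4ssv<2svm+1⇔2s≤m s v m sv≥1 ⇔-∘ ∣dd-√kk⁺∣<⇔ s v m 1 s≥1 v≥1 m≥1 ℕP.≤-refl (s≤s z≤n))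
  where
  sv≥1 = ℕP.*-mono-≤ s≥1 v≥1
  +0≤m : ∀ {P : Set} {n} → P ⇔ n ≤ m → P ⇔ n + 0 ≤ m
  +0≤m {n = n} = subst (λ k → _ ⇔ k ≤ m) (sym (ℕP.+-identityʳ n))
lemma4p1 s v m s≥1 v≥1 _ minus not-excluded =
    4+4ssv<4svm⇔s+1≤m s v m s≥1 v≥1 vmm≥5 ⇔-∘ ∣dd-√kk⁻∣<⇔ s v m 2 s≥1 v≥1 vmm≥5 (s≤s z≤n) ℕP.≤-refl
  , 1+4ssv<2svm⇔2s+1≤m s v m sv≥1 ⇔-∘ ∣dd-√kk⁻∣<⇔ s v m 1 s≥1 v≥1 vmm≥5 ℕP.≤-refl (s≤s z≤n)
  where
  sv≥1 = ℕP.*-mono-≤ s≥1 v≥1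
  vmm≥5 : 5 ≤ v * m * m
  vmm≥5 = subst (5 ≤_) (sym (ℕP.*-assoc v m m)) (ℕP.≰⇒> λ vm²≤4 → not-excluded (refl , vm²≤4))
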